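{- Suppose $\lim_{n\to\infty} h(n)/p_{n+1}^2 = 0$. Then for every positive integer $d$ and every integer $a$ with $\gcd(a,d)=1$, the set $a+d\mathbb{Z}=\{a+dn : n\in\mathbb{Z}\}$ contains at least one (positive) prime.
   Context: $p_j$ denotes the $j$th prime ($p_1=2,p_2=3,\dots$). The primorial is $p_k\# = \prod_{j=1}^k p_j$. For a positive integer $n$, the Jacobsthal function $g(n)$ is the smallest positive integer $m$ such that every sequence of $m$ consecutive integers contains at least one integer coprime to $n$. The primorial Jacobsthal function is $h(k)=g(p_k\#)$. "Prime" means positive prime. -}

module Defs where

open import Data.Nat using (ℕ; zero; suc; _+_; _*_; _<_; _≤_)
open import Data.Bool using (if_then_else_)
open import Data.Product using (_×_; ∃; Σ)
open import Data.Integer as ℤ using (ℤ)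
open import Data.Nat.Primality using (Prime; prime?)
open import Data.Nat.Coprimality using (Coprime)
open import Relation.Nullary using (¬_; does)
open import Relation.Binary.PropositionalEquality using (_≡_)

-- number of primes strictly below n
primeCount : ℕ → ℕ
primeCount zero    = zero
primeCount (suc n) = (if does (prime? n) then 1 else 0) + primeCount n

-- q is the j-th prime p_j (1-indexed: p_1 = 2, p_2 = 3, ...)
IsNthPrime : ℕ → ℕ → Set
IsNthPrime j q = Prime q × suc (primeCount q) ≡ j

primorialUpTo : ℕ → ℕ
primorialUpTo zero    = 1
primorialUpTo (suc x) = (if does (prime? (suc x)) then suc x else 1) * primorialUpTo x

EveryBlockHasCoprime : ℕ → ℕ → Set
EveryBlockHasCoprime n m =
  ∀ (a : ℤ) → ∃ λ i → i < m × Coprime ℤ.∣ a ℤ.+ ℤ.+ i ∣ n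

IsJacobsthal : ℕ → ℕ → Set
IsJacobsthal n m =
  0 < m × EveryBlockHasCoprime n m ×
  (∀ m' → 0 < m' → m' < m → ¬ EveryBlockHasCoprime n m')

-- m = h(k) = g(p_k #)
IsPrimorialJacobsthal : ℕ → ℕ → Set
IsPrimorialJacobsthal k m = ∀ pk → IsNthPrime k pk → IsJacobsthal (primorialUpTo pk) m

-- lim_{n→∞} h(n) / p_{n+1}^2 = 0, written out with ε = 1/K:
-- for every K > 0, eventually K * h(n) < p_{n+1}^2
HypothesisLimitZero : Set
HypothesisLimitZero =
  ∀ (K : ℕ) → 0 < K → ∃ λ N → ∀ n → N ≤ n →
    ∀ m q → IsPrimorialJacobsthal n m → IsNthPrime (suc n) q → K * m < q * q

{-# OPTIONS --safe #-}
-- Fix a residue r < d coprime to d, and take k so large that 3d·h(k) < p_{k+1}², where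
-- P = p_k#.  Let Q be the product of the primes ≤ p_k not dividing d, and e an inverse
-- of d modulo Q.  Some e·r + t with 2 ≤ t < h(k) + 2 is coprime to P; then y = r + d·t
-- has no prime factor ≤ p_k: a prime dividing d would divide r, and every other one
-- divides Q, where e·y ≡ e·r + t.  Since 2 ≤ y < d·(h(k) + 2) ≤ 3d·h(k) < p_{k+1}², y is prime.
module Submission where

open import Defs
open import Data.Nat
open import Data.Nat.Properties
open import Data.Nat.Divisibility
open import Data.Nat.Primality
open import Data.Nat.Primality.Factorisation using (factorise)
open import Data.Nat.Coprimality
  using (Coprime; coprime?; coprime-+; 1-coprimeTo; coprime-divisor; coprime-Bézout)
import Data.Nat.Coprimality as Coprimality
open import Data.Nat.GCD using (module Bézout)
open import Data.Integer as ℤ using (ℤ; +_; 1ℤ)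
import Data.Integer.Divisibility.Signed as ℤ
import Data.Integer.Properties as ℤ
open import Data.Integer.DivMod using (_%ℕ_; _/ℕ_; n%ℕd<d; a≡a%ℕn+[a/ℕn]*n)
open import Data.Integer.Tactic.RingSolver using (solve-∀)
open import Data.List using ([]; _∷_)
open import Data.List.Relation.Unary.All using (_∷_)
open import Data.Bool using (if_then_else_)
open import Data.Product
open import Data.Sum using (_⊎_; inj₁; inj₂)
open import Data.Empty using (⊥-elim)
open import Level using (0ℓ)
open import Relation.Nullary
open import Relation.Unary using (Pred; Decidable)
open import Relation.Binary.PropositionalEquality

module _ {P : Pred ℕ 0ℓ} (P? : Decidable P) where

  Least : ℕ → Set
  Least m = P m × (∀ {k} → k < m → ¬ P k)

  least-or-none : ∀ n → ∃ Least ⊎ (∀ {k} → k < n → ¬ P k)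
  least-or-none zero = inj₂ λ ()
  least-or-none (suc n) with least-or-none n | P? n
  ... | inj₁ m-least | _      = inj₁ m-least
  ... | inj₂ none    | yes pn = inj₁ (n , pn , none)
  ... | inj₂ none    | no ¬pn = inj₂ none≤n
    where
    none≤n : ∀ {k} → k < suc n → ¬ P k
    none≤n k<1+n with m<1+n⇒m<n∨m≡n k<1+n
    ... | inj₁ k<n  = none k<n
    ... | inj₂ refl = ¬pn

  least : ∀ {n} → P n → ∃ Least
  least {n} pn with least-or-none (suc n)
  ... | inj₁ m-least = m-least
  ... | inj₂ none    = ⊥-elim (none ≤-refl pn)

coprime⇒¬prime∣both : ∀ {m n p} → Coprime m n → Prime p → p ∣ m → ¬ p ∣ n
coprime⇒¬prime∣both m⊥n pp p∣m p∣n = ¬prime[1] (subst Prime (m⊥n (p∣m , p∣n)) pp)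

prime∤⇒coprime : ∀ {p n} → Prime p → ¬ p ∣ n → Coprime p n
prime∤⇒coprime pp p∤n (i∣p , i∣n) with prime⇒irreducible pp i∣p
... | inj₁ i≡1  = i≡1
... | inj₂ refl = ⊥-elim (p∤n i∣n)

coprime-* : ∀ {m n o} → Coprime m o → Coprime n o → Coprime (m * n) o
coprime-* {m} {n} m⊥o n⊥o {i} (i∣mn , i∣o) =
  m⊥o (coprime-divisor i⊥n (subst (i ∣_) (*-comm m n) i∣mn) , i∣o)
  where
  i⊥n : Coprime i n
  i⊥n (j∣i , j∣n) = n⊥o (j∣n , ∣-trans j∣i i∣o)

coprime-+-* : ∀ x k n → Coprime ℤ.∣ x ∣ n → Coprime ℤ.∣ x ℤ.+ k ℤ.* + n ∣ n
coprime-+-* x k n x⊥n {i} (i∣x+kn , i∣n) = x⊥n (ℤ.∣⇒∣ᵤ i∣x , i∣n)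
  where
  i∣x : + i ℤ.∣ x
  i∣x = ℤ.∣m+n∣n⇒∣m (ℤ.∣ᵤ⇒∣ i∣x+kn) (ℤ.∣n⇒∣m*n k (ℤ.∣ᵤ⇒∣ {+ i} {+ n} i∣n))

coprime-%ℕ : ∀ a d .{{_ : NonZero d}} → Coprime ℤ.∣ a ∣ d → Coprime (a %ℕ d) d
coprime-%ℕ a d a⊥d =
  subst (λ w → Coprime ℤ.∣ w ∣ d) a-[a/d]d≡a%d (coprime-+-* a (ℤ.- (a /ℕ d)) d a⊥d)
  where
  cancel : ∀ r q d → r ℤ.+ q ℤ.* d ℤ.+ ℤ.- q ℤ.* d ≡ r
  cancel = solve-∀
  a-[a/d]d≡a%d : a ℤ.+ ℤ.- (a /ℕ d) ℤ.* + d ≡ + (a %ℕ d)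
  a-[a/d]d≡a%d = trans (cong (λ w → w ℤ.+ ℤ.- (a /ℕ d) ℤ.* + d) (a≡a%ℕn+[a/ℕn]*n a d))
                       (cancel (+ (a %ℕ d)) (a /ℕ d) (+ d))

ℕ-bézout⇒ℤ : ∀ a b c d → 1 + a * b ≡ c * d → + c ℤ.* + d ℤ.- + a ℤ.* + b ≡ 1ℤ
ℕ-bézout⇒ℤ a b c d 1+ab≡cd = begin
  + c ℤ.* + d ℤ.- + a ℤ.* + b    ≡⟨ cong₂ ℤ._-_ (ℤ.pos-* c d) (ℤ.pos-* a b) ⟨
  + (c * d) ℤ.- + (a * b)        ≡⟨ cong (λ u → + u ℤ.- + (a * b)) 1+ab≡cd ⟨
  1ℤ ℤ.+ + (a * b) ℤ.- + (a * b) ≡⟨ cancel (+ (a * b)) ⟩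
  1ℤ                             ∎
  where
  open ≡-Reasoning
  cancel : ∀ u → 1ℤ ℤ.+ u ℤ.- u ≡ 1ℤ
  cancel = solve-∀

coprime⇒ℤ-bézout : ∀ {m n} → Coprime m n → ∃₂ λ x y → x ℤ.* + m ℤ.+ y ℤ.* + n ≡ 1ℤ
coprime⇒ℤ-bézout {m} {n} m⊥n with coprime-Bézout m⊥n
... | Bézout.+- x y 1+yn≡xm = + x , ℤ.- + y ,
  trans (swap-sub (+ x) (+ m) (+ y) (+ n)) (ℕ-bézout⇒ℤ y n x m 1+yn≡xm)
  where
  swap-sub : ∀ x m y n → x ℤ.* m ℤ.+ ℤ.- y ℤ.* n ≡ x ℤ.* m ℤ.- y ℤ.* n
  swap-sub = solve-∀
... | Bézout.-+ x y 1+xm≡yn = ℤ.- + x , + y ,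
  trans (swap-sub (+ x) (+ m) (+ y) (+ n)) (ℕ-bézout⇒ℤ x m y n 1+xm≡yn)
  where
  swap-sub : ∀ x m y n → ℤ.- x ℤ.* m ℤ.+ y ℤ.* n ≡ y ℤ.* n ℤ.- x ℤ.* m
  swap-sub = solve-∀

noPrimeFactor<⇒rough : ∀ {m n} → (∀ {p} → Prime p → p < m → ¬ p ∣ n) → m Rough n
noPrimeFactor<⇒rough {0} _ = 0-rough
noPrimeFactor<⇒rough {1} _ = 1-rough
noPrimeFactor<⇒rough {2} _ = 2-rough
noPrimeFactor<⇒rough {suc (2+ m)} noFactor
  with noPrimeFactor<⇒rough {2+ m} (λ pp p<2+m → noFactor pp (m<n⇒m<1+n p<2+m))
... | 2+m-rough =
  ∤⇒rough-suc (λ 2+m∣n → noFactor (rough∧∣⇒prime 2+m-rough 2+m∣n) ≤-refl 2+m∣n) 2+m-rough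

primeCount-suc-prime : ∀ {n} → Prime n → primeCount (suc n) ≡ suc (primeCount n)
primeCount-suc-prime {n} pn with prime? n
... | yes _  = refl
... | no ¬pn = ⊥-elim (¬pn pn)

primeCount-≤-suc : ∀ n → primeCount n ≤ primeCount (suc n)
primeCount-≤-suc n with prime? n
... | yes _ = n≤1+n _
... | no _  = ≤-refl

primeCount-suc-≤ : ∀ n → primeCount (suc n) ≤ suc (primeCount n)
primeCount-suc-≤ n with prime? n
... | yes _ = ≤-refl
... | no _  = n≤1+n _

primeCount-<-suc⇒prime : ∀ {n} → primeCount n < primeCount (suc n) → Prime n
primeCount-<-suc⇒prime {n} πn<π[1+n] with prime? n
... | yes pn = pn
... | no _   = ⊥-elim (<-irrefl refl πn<π[1+n])

primeCount-mono-≤ : ∀ {m n} → m ≤ n → primeCount m ≤ primeCount n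
primeCount-mono-≤ m≤n = go (≤⇒≤′ m≤n)
  where
  go : ∀ {m n} → m ≤′ n → primeCount m ≤ primeCount n
  go ≤′-refl              = ≤-refl
  go (≤′-step {n} m≤′n) = ≤-trans (go m≤′n) (primeCount-≤-suc n)

primeCount-<-prime : ∀ {p n} → Prime p → p < n → primeCount p < primeCount n
primeCount-<-prime {p} {n} pp p<n = begin-strict
  primeCount p       <⟨ n<1+n _ ⟩
  suc (primeCount p) ≡⟨ primeCount-suc-prime pp ⟨
  primeCount (suc p) ≤⟨ primeCount-mono-≤ p<n ⟩
  primeCount n       ∎
  where open ≤-Reasoning

primorialUpTo∣primorialUpTo-suc : ∀ x → primorialUpTo x ∣ primorialUpTo (suc x)
primorialUpTo∣primorialUpTo-suc x = n∣m*n (if does (prime? (suc x)) then suc x else 1)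

∣primorialUpTo : ∀ {p} x → Prime p → p ≤ x → p ∣ primorialUpTo x
∣primorialUpTo zero pp p≤0 = ⊥-elim (¬prime[0] (subst Prime (n≤0⇒n≡0 p≤0) pp))
∣primorialUpTo (suc x) pp p≤1+x with m≤n⇒m<n∨m≡n p≤1+x
... | inj₁ p<1+x = ∣-trans (∣primorialUpTo x pp (s≤s⁻¹ p<1+x)) (primorialUpTo∣primorialUpTo-suc x)
... | inj₂ refl with prime? (suc x)
...   | yes _  = m∣m*n (primorialUpTo x)
...   | no ¬pp = ⊥-elim (¬pp pp)

primorialUpTo-nonZero : ∀ x → NonZero (primorialUpTo x)
primorialUpTo-nonZero zero = _
primorialUpTo-nonZero (suc x) with prime? (suc x)
... | yes _ = m*n≢0 (suc x) (primorialUpTo x) {{_}} {{primorialUpTo-nonZero x}}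
... | no _  = m*n≢0 1 (primorialUpTo x) {{_}} {{primorialUpTo-nonZero x}}

∃prime> : ∀ x → ∃ λ p → x < p × Prime p
∃prime> x with factorise (suc (primorialUpTo x))
... | record { factors = [] ; isFactorisation = eq } =
  ⊥-elim (≢-nonZero⁻¹ _ {{primorialUpTo-nonZero x}} (suc-injective eq))
... | record { factors = p ∷ _ ; isFactorisation = eq ; factorsPrime = pp ∷ _ } =
  p , ≰⇒> p≰x , pp
  where
  p∣P+1 : p ∣ primorialUpTo x + 1
  p∣P+1 = subst (p ∣_) (trans (sym eq) (+-comm 1 _)) (m∣m*n _)
  p≰x : ¬ p ≤ x
  p≰x p≤x = ¬prime[1] (subst Prime (∣1⇒≡1 (∣m+n∣m⇒∣n p∣P+1 (∣primorialUpTo x pp p≤x))) pp)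

primeCount-unbounded : ∀ k → ∃ λ x → k ≤ primeCount x
primeCount-unbounded zero    = 0 , z≤n
primeCount-unbounded (suc k) with primeCount-unbounded k
... | x , k≤πx with ∃prime> x
...   | p , x<p , pp = suc p , (begin
  suc k              ≤⟨ s≤s k≤πx ⟩
  suc (primeCount x) ≤⟨ s≤s (primeCount-mono-≤ (<⇒≤ x<p)) ⟩
  suc (primeCount p) ≡⟨ primeCount-suc-prime pp ⟨
  primeCount (suc p) ∎)
  where open ≤-Reasoning

nthPrime : ∀ j → ∃ (IsNthPrime (suc j))
nthPrime j with primeCount-unbounded (suc j)
... | x , j<πx with least (λ x → suc j ≤? primeCount x) {x} j<πx
...   | zero  , () , _
...   | suc q , j<π[1+q] , minimal = q , primeCount-<-suc⇒prime πq<π[1+q] , cong suc πq≡j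
  where
  πq≡j : primeCount q ≡ j
  πq≡j = ≤-antisym (≮⇒≥ (minimal ≤-refl)) (s≤s⁻¹ (≤-trans j<π[1+q] (primeCount-suc-≤ q)))
  πq<π[1+q] : primeCount q < primeCount (suc q)
  πq<π[1+q] = subst (_< primeCount (suc q)) (sym πq≡j) j<π[1+q]

nthPrime-unique : ∀ {k p p′} → IsNthPrime k p → IsNthPrime k p′ → p ≡ p′
nthPrime-unique {p = p} {p′} (pp , πp) (pp′ , πp′) =
  ≤-antisym (≮⇒≥ (not-< pp′ (sym πp≡πp′))) (≮⇒≥ (not-< pp πp≡πp′))
  where
  πp≡πp′ : primeCount p ≡ primeCount p′
  πp≡πp′ = suc-injective (trans πp (sym πp′))
  not-< : ∀ {m n} → Prime m → primeCount m ≡ primeCount n → ¬ m < n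
  not-< pm πm≡πn m<n = <-irrefl πm≡πn (primeCount-<-prime pm m<n)

≤nthPrime : ∀ {k pₖ pₖ₊₁ p} → IsNthPrime k pₖ → IsNthPrime (suc k) pₖ₊₁ →
            Prime p → p < pₖ₊₁ → p ≤ pₖ
≤nthPrime {k} {pₖ} {pₖ₊₁} {p} (ppₖ , πpₖ) (_ , πpₖ₊₁) pp p<pₖ₊₁ =
  ≮⇒≥ λ pₖ<p → <-irrefl refl (begin-strict
    k                   ≡⟨ πpₖ ⟨
    suc (primeCount pₖ) ≤⟨ primeCount-<-prime ppₖ pₖ<p ⟩
    primeCount p        <⟨ primeCount-<-prime pp p<pₖ₊₁ ⟩
    primeCount pₖ₊₁     ≡⟨ suc-injective πpₖ₊₁ ⟩
    k                   ∎)
  where open ≤-Reasoning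

primorialCoprimeTo : ℕ → ℕ → ℕ
primorialCoprimeTo d zero = 1
primorialCoprimeTo d (suc x) with prime? (suc x) ×-dec ¬? (suc x ∣? d)
... | yes _ = suc x * primorialCoprimeTo d x
... | no _  = primorialCoprimeTo d x

primorialCoprimeTo-coprime : ∀ d x → Coprime (primorialCoprimeTo d x) d
primorialCoprimeTo-coprime d zero = 1-coprimeTo d
primorialCoprimeTo-coprime d (suc x) with prime? (suc x) ×-dec ¬? (suc x ∣? d)
... | yes (pp , p∤d) = coprime-* (prime∤⇒coprime pp p∤d) (primorialCoprimeTo-coprime d x)
... | no _           = primorialCoprimeTo-coprime d x

∣primorialCoprimeTo : ∀ {p d} x → Prime p → ¬ p ∣ d → p ≤ x → p ∣ primorialCoprimeTo d x
∣primorialCoprimeTo zero pp _ p≤0 = ⊥-elim (¬prime[0] (subst Prime (n≤0⇒n≡0 p≤0) pp))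
∣primorialCoprimeTo {p} {d} (suc x) pp p∤d p≤1+x
  with prime? (suc x) ×-dec ¬? (suc x ∣? d) | m≤n⇒m<n∨m≡n p≤1+x
... | yes _        | inj₁ p<1+x = ∣n⇒∣m*n (suc x) (∣primorialCoprimeTo x pp p∤d (s≤s⁻¹ p<1+x))
... | no _         | inj₁ p<1+x = ∣primorialCoprimeTo x pp p∤d (s≤s⁻¹ p<1+x)
... | yes _        | inj₂ refl  = m∣m*n (primorialCoprimeTo d x)
... | no ¬[pp×p∤d] | inj₂ refl  = ⊥-elim (¬[pp×p∤d] (pp , p∤d))

-- The blocks starting in [0, n) suffice by periodicity, which makes the property decidable.
EveryResidueBlockHasCoprime : ℕ → ℕ → Set
EveryResidueBlockHasCoprime n m = ∀ {a} → a < n → ∃ λ i → i < m × Coprime (a + i) n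

everyResidueBlockHasCoprime? : ∀ n m → Dec (EveryResidueBlockHasCoprime n m)
everyResidueBlockHasCoprime? n m = allUpTo? (λ a → anyUpTo? (λ i → coprime? (a + i) n) m) n

everyResidueBlock⇒everyBlock : ∀ {n m} .{{_ : NonZero n}} →
  EveryResidueBlockHasCoprime n m → EveryBlockHasCoprime n m
everyResidueBlock⇒everyBlock {n} residueBlocks a with residueBlocks (n%ℕd<d a n)
... | i , i<m , a%n+i⊥n = i , i<m ,
  subst (λ w → Coprime ℤ.∣ w ∣ n) a%n+i+[a/n]n≡a+i (coprime-+-* (+ (a %ℕ n + i)) (a /ℕ n) n a%n+i⊥n)
  where
  shuffle : ∀ r i q n → (r ℤ.+ i) ℤ.+ q ℤ.* n ≡ (r ℤ.+ q ℤ.* n) ℤ.+ i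
  shuffle = solve-∀
  a%n+i+[a/n]n≡a+i : + (a %ℕ n + i) ℤ.+ (a /ℕ n) ℤ.* + n ≡ a ℤ.+ + i
  a%n+i+[a/n]n≡a+i = trans (shuffle (+ (a %ℕ n)) (+ i) (a /ℕ n) (+ n))
                           (cong (ℤ._+ + i) (sym (a≡a%ℕn+[a/ℕn]*n a n)))

everyBlockHasCoprime? : ∀ n .{{_ : NonZero n}} m → Dec (EveryBlockHasCoprime n m)
everyBlockHasCoprime? n m =
  map′ everyResidueBlock⇒everyBlock (λ blocks _ → blocks (+ _)) (everyResidueBlockHasCoprime? n m)

everyResidueBlockHasCoprime-2+n : ∀ n → EveryResidueBlockHasCoprime n (2 + n)
everyResidueBlockHasCoprime-2+n n {a} a<n = suc n ∸ a , s≤s (m∸n≤m (suc n) a) ,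
  subst (λ x → Coprime x n) (trans (+-comm n 1) (sym (m+[n∸m]≡n (m≤n⇒m≤1+n (<⇒≤ a<n)))))
    (coprime-+ (1-coprimeTo n))

jacobsthal : ∀ n .{{_ : NonZero n}} → ∃ (IsJacobsthal n)
jacobsthal n with least (λ m → (0 <? m) ×-dec everyBlockHasCoprime? n m)
                        {2 + n} (z<s , everyResidueBlock⇒everyBlock (everyResidueBlockHasCoprime-2+n n))
... | m , (0<m , blocks) , minimal =
  m , 0<m , blocks , λ m′ 0<m′ m′<m blocks′ → minimal m′<m (0<m′ , blocks′)

∣r+dt⇒∣er+t : ∀ {p Q d e g} r t → e ℤ.* + d ℤ.+ g ℤ.* + Q ≡ 1ℤ →
              p ∣ Q → p ∣ r + d * t → p ∣ ℤ.∣ e ℤ.* + r ℤ.+ + t ∣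
∣r+dt⇒∣er+t {p} {Q} {d} {e} {g} r t ed+gQ≡1 p∣Q p∣r+dt =
  ℤ.∣⇒∣ᵤ (subst (+ p ℤ.∣_) e[r+dt]+gtQ≡er+t
    (ℤ.∣m∣n⇒∣m+n (ℤ.∣n⇒∣m*n e (ℤ.∣ᵤ⇒∣ {+ p} {+ (r + d * t)} p∣r+dt))
                 (ℤ.∣n⇒∣m*n (g ℤ.* + t) (ℤ.∣ᵤ⇒∣ {+ p} {+ Q} p∣Q))))
  where
  open ≡-Reasoning
  regroup : ∀ e r d t g Q →
            e ℤ.* (r ℤ.+ d ℤ.* t) ℤ.+ g ℤ.* t ℤ.* Q ≡ e ℤ.* r ℤ.+ t ℤ.* (e ℤ.* d ℤ.+ g ℤ.* Q)
  regroup = solve-∀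
  e[r+dt]+gtQ≡er+t : e ℤ.* + (r + d * t) ℤ.+ g ℤ.* + t ℤ.* + Q ≡ e ℤ.* + r ℤ.+ + t
  e[r+dt]+gtQ≡er+t = begin
    e ℤ.* (+ r ℤ.+ + (d * t)) ℤ.+ g ℤ.* + t ℤ.* + Q
      ≡⟨ cong (λ u → e ℤ.* (+ r ℤ.+ u) ℤ.+ g ℤ.* + t ℤ.* + Q) (ℤ.pos-* d t) ⟩
    e ℤ.* (+ r ℤ.+ + d ℤ.* + t) ℤ.+ g ℤ.* + t ℤ.* + Q
      ≡⟨ regroup e (+ r) (+ d) (+ t) g (+ Q) ⟩
    e ℤ.* + r ℤ.+ + t ℤ.* (e ℤ.* + d ℤ.+ g ℤ.* + Q)
      ≡⟨ cong (λ u → e ℤ.* + r ℤ.+ + t ℤ.* u) ed+gQ≡1 ⟩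
    e ℤ.* + r ℤ.+ + t ℤ.* 1ℤ
      ≡⟨ cong (λ u → e ℤ.* + r ℤ.+ u) (ℤ.*-identityʳ (+ t)) ⟩
    e ℤ.* + r ℤ.+ + t ∎

primeInProgression : ∀ {d r k pₖ pₖ₊₁ m} → r < d → Coprime r d →
  IsNthPrime k pₖ → IsNthPrime (suc k) pₖ₊₁ →
  EveryBlockHasCoprime (primorialUpTo pₖ) m → d * (2 + m) ≤ pₖ₊₁ * pₖ₊₁ →
  ∃ λ t → Prime (r + d * t)
primeInProgression {d} {r} {pₖ = pₖ} {pₖ₊₁} {m} r<d r⊥d pₖ-nth pₖ₊₁-nth blocks d[2+m]≤pₖ₊₁²
  with coprime⇒ℤ-bézout (Coprimality.sym (primorialCoprimeTo-coprime d pₖ))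
... | e , g , ed+gQ≡1 with blocks (e ℤ.* + r ℤ.+ + 2)
... | i , i<m , er+2+i⊥P = t , rough∧square>⇒prime {{n>1⇒nonTrivial 2≤y}} y-rough y<pₖ₊₁²
  where
  t y : ℕ
  t = 2 + i
  y = r + d * t

  er+t⊥P : Coprime ℤ.∣ e ℤ.* + r ℤ.+ + t ∣ (primorialUpTo pₖ)
  er+t⊥P = subst (λ w → Coprime ℤ.∣ w ∣ (primorialUpTo pₖ))
                 (ℤ.+-assoc (e ℤ.* + r) (+ 2) (+ i)) er+2+i⊥P

  noSmallFactor : ∀ {p} → Prime p → p < pₖ₊₁ → ¬ p ∣ y
  noSmallFactor {p} pp p<pₖ₊₁ p∣y with p ∣? d
  ... | yes p∣d = coprime⇒¬prime∣both r⊥d pp p∣r p∣d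
    where
    p∣r : p ∣ r
    p∣r = ∣m+n∣m⇒∣n (subst (p ∣_) (+-comm r (d * t)) p∣y) (∣m⇒∣m*n t p∣d)
  ... | no p∤d = coprime⇒¬prime∣both er+t⊥P pp
    (∣r+dt⇒∣er+t {e = e} {g} r t ed+gQ≡1 (∣primorialCoprimeTo pₖ pp p∤d p≤pₖ) p∣y)
    (∣primorialUpTo pₖ pp p≤pₖ)
    where
    p≤pₖ : p ≤ pₖ
    p≤pₖ = ≤nthPrime pₖ-nth pₖ₊₁-nth pp p<pₖ₊₁

  y-rough : pₖ₊₁ Rough y
  y-rough = noPrimeFactor<⇒rough noSmallFactor

  2≤y : 2 ≤ y
  2≤y = begin
    2     ≤⟨ *-monoˡ-≤ 2 (≤-<-trans z≤n r<d) ⟩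
    d * 2 ≤⟨ *-monoʳ-≤ d (m≤m+n 2 i) ⟩
    d * t ≤⟨ m≤n+m (d * t) r ⟩
    y     ∎
    where open ≤-Reasoning

  y<pₖ₊₁² : y < pₖ₊₁ * pₖ₊₁
  y<pₖ₊₁² = begin-strict
    r + d * t   <⟨ +-monoˡ-< (d * t) r<d ⟩
    d + d * t   ≡⟨ *-suc d t ⟨
    d * (3 + i) ≤⟨ *-monoʳ-≤ d (+-monoʳ-≤ 2 i<m) ⟩
    d * (2 + m) ≤⟨ d[2+m]≤pₖ₊₁² ⟩
    pₖ₊₁ * pₖ₊₁ ∎
    where open ≤-Reasoning

d*[2+m]≤3*d*m : ∀ d {m} → 0 < m → d * (2 + m) ≤ 3 * d * m
d*[2+m]≤3*d*m d {m} 0<m = begin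
  d * (2 + m)     ≤⟨ *-monoʳ-≤ d (+-monoˡ-≤ m (*-monoʳ-≤ 2 0<m)) ⟩
  d * (2 * m + m) ≡⟨ cong (d *_) (+-comm (2 * m) m) ⟩
  d * (3 * m)     ≡⟨ *-assoc d 3 m ⟨
  d * 3 * m       ≡⟨ cong (_* m) (*-comm d 3) ⟩
  3 * d * m       ∎
  where open ≤-Reasoning

primeInResidueClass : HypothesisLimitZero →
  ∀ {d r} → r < d → Coprime r d → ∃ λ t → Prime (r + d * t)
primeInResidueClass hyp {d} r<d r⊥d with hyp (3 * d) (*-monoʳ-< 3 (≤-<-trans z≤n r<d))
... | N , eventually with nthPrime N | nthPrime (suc N)
... | pₖ , pₖ-nth | pₖ₊₁ , pₖ₊₁-nth with jacobsthal (primorialUpTo pₖ) {{primorialUpTo-nonZero pₖ}}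
... | m , 0<m , blocks , minimal = primeInProgression r<d r⊥d pₖ-nth pₖ₊₁-nth blocks
  (≤-trans (d*[2+m]≤3*d*m d 0<m) (<⇒≤ (eventually (suc N) (n≤1+n N) m pₖ₊₁ hₖ≡m pₖ₊₁-nth)))
  where
  hₖ≡m : IsPrimorialJacobsthal (suc N) m
  hₖ≡m p p-nth = subst (λ p → IsJacobsthal (primorialUpTo p) m) (nthPrime-unique pₖ-nth p-nth)
                       (0<m , blocks , minimal)

∃prime[r+dℕ]⇒∃prime[a+dℤ] : ∀ d .{{_ : NonZero d}} →
  (∀ {r} → r < d → Coprime r d → ∃ λ t → Prime (r + d * t)) →
  ∀ a → Coprime ℤ.∣ a ∣ d → ∃ λ n → ∃ λ p → Prime p × + p ≡ a ℤ.+ + d ℤ.* n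
∃prime[r+dℕ]⇒∃prime[a+dℤ] d primeInResidue a a⊥d
  with primeInResidue (n%ℕd<d a d) (coprime-%ℕ a d a⊥d)
... | t , p-prime = + t ℤ.- a /ℕ d , a %ℕ d + d * t , p-prime , r+dt≡a+d[t-q]
  where
  regroup : ∀ r q d t → r ℤ.+ d ℤ.* t ≡ r ℤ.+ q ℤ.* d ℤ.+ d ℤ.* (t ℤ.- q)
  regroup = solve-∀
  r+dt≡a+d[t-q] : + (a %ℕ d + d * t) ≡ a ℤ.+ + d ℤ.* (+ t ℤ.- a /ℕ d)
  r+dt≡a+d[t-q] = begin
    + (a %ℕ d) ℤ.+ + (d * t)
      ≡⟨ cong (λ u → + (a %ℕ d) ℤ.+ u) (ℤ.pos-* d t) ⟩
    + (a %ℕ d) ℤ.+ + d ℤ.* + t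
      ≡⟨ regroup (+ (a %ℕ d)) (a /ℕ d) (+ d) (+ t) ⟩
    + (a %ℕ d) ℤ.+ a /ℕ d ℤ.* + d ℤ.+ + d ℤ.* (+ t ℤ.- a /ℕ d)
      ≡⟨ cong (λ u → u ℤ.+ + d ℤ.* (+ t ℤ.- a /ℕ d)) (a≡a%ℕn+[a/ℕn]*n a d) ⟨
    a ℤ.+ + d ℤ.* (+ t ℤ.- a /ℕ d) ∎
    where open ≡-Reasoning

corollary2p11 : HypothesisLimitZero → ∀ (d : ℕ) → 0 < d → ∀ (a : ℤ) → Coprime ℤ.∣ a ∣ d → ∃ λ (n : ℤ) → ∃ λ (p : ℕ) → Prime p × ℤ.+ p ≡ a ℤ.+ ℤ.+ d ℤ.* n
corollary2p11 hyp d 0<d = ∃prime[r+dℕ]⇒∃prime[a+dℤ] d {{>-nonZero 0<d}} (primeInResidueClass hyp)
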